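{- Let $(G,\Sigma,\chi,w)$ be an instance of Decoder Retrieval and let $\{a,b\}$ be a one-sided letter pair. Then every solution $\mathcal{D}$ satisfies $|\mathcal{D}\cap\{ab,ba\}|=1$.
   Context: An instance of Decoder Retrieval consists of a finite simple graph $G=(V,E)$, a finite alphabet $\Sigma$, a coloring $\chi\colon V\to\Sigma$ and a word $w\in\Sigma^{|V|}$, where for every $a\in\Sigma$ the set $V_a=\chi^{ -1}(a)$ is non-empty and $w$ contains $a$ exactly $|V_a|$ times. A set $\mathcal{D}\subseteq\Sigma^2$ is a solution if there is a graph isomorphism $f$ from $G$ to the letter graph $G(\mathcal{D},w)$ with $w_{f(v)}=\chi(v)$ for all $v$, where $G(\mathcal{D},w)$ has vertex set $\{1,\dots,|w|\}$ and edges $\{i,j\}$ for $i<j$ with $w_iw_j\in\mathcal{D}$. For vertex sets $X,Y$, $E(X,Y)$ is the set of edges with one endpoint in $X$ and one in $Y$. An unordered pair $\{a,b\}$ of distinct letters is one-sided if $0<|E(V_a,V_b)|<|V_a|\cdot|V_b|$. -}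

module Defs where

open import Data.Nat using (ℕ; zero; suc; _+_; _*_; _<_)
open import Data.Bool using (Bool; true; false; _∧_; _∨_; if_then_else_)
open import Data.Fin using (Fin; zero; suc; _<?_)
open import Data.Fin.Properties using (_≟_)
open import Data.Product using (Σ; _×_; ∃-syntax)
open import Relation.Nullary.Decidable using (⌊_⌋)
open import Relation.Binary.PropositionalEquality using (_≡_; _≢_)
open import Function.Bundles using (_⤖_; Bijection; _⇔_)

count : ∀ {n} → (Fin n → Bool) → ℕ
count {zero}  p = 0
count {suc n} p = (if p zero then 1 else 0) + count (λ i → p (suc i))

record SimpleGraph (n : ℕ) : Set where
  field
    adj   : Fin n → Fin n → Bool
    sym   : ∀ u v → adj u v ≡ adj v u
    irrefl : ∀ v → adj v v ≡ false
open SimpleGraph public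

inClass : ∀ {n k} → (Fin n → Fin k) → Fin k → Fin n → Bool
inClass χ a v = ⌊ χ v ≟ a ⌋

classSize : ∀ {n k} → (Fin n → Fin k) → Fin k → ℕ
classSize χ a = count (inClass χ a)

occurrences : ∀ {n k} → (Fin n → Fin k) → Fin k → ℕ
occurrences w a = count (λ i → ⌊ w i ≟ a ⌋)

-- Decoder Retrieval instance: graph G on Fin n, alphabet Σ = Fin k,
-- coloring χ, word w of length |V| = n (positions Fin n)
record IsInstance {n k : ℕ} (G : SimpleGraph n) (χ : Fin n → Fin k)
                  (w : Fin n → Fin k) : Set where
  field
    classNonempty : ∀ a → ∃[ v ] χ v ≡ a
    wordCounts    : ∀ a → occurrences w a ≡ classSize χ a

-- a set D ⊆ Σ² is given by its (Boolean) characteristic function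
-- letter graph G(D,w): edge {i,j} for i<j with w_i w_j ∈ D
letterAdj : ∀ {n k} → (Fin k → Fin k → Bool) → (Fin n → Fin k) → Fin n → Fin n → Bool
letterAdj D w i j = (⌊ i <? j ⌋ ∧ D (w i) (w j)) ∨ (⌊ j <? i ⌋ ∧ D (w j) (w i))

IsSolution : ∀ {n k} → SimpleGraph n → (Fin n → Fin k) → (Fin n → Fin k)
           → (Fin k → Fin k → Bool) → Set
IsSolution {n} G χ w D =
  Σ (Fin n ⤖ Fin n) λ f →
    let open Bijection f using (to) in
    (∀ u v → adj G u v ≡ letterAdj D w (to u) (to v)) × (∀ v → w (to v) ≡ χ v)

sumFin : ∀ {m} → (Fin m → ℕ) → ℕ
sumFin {zero}  f = 0
sumFin {suc m} f = f zero + sumFin (λ i → f (suc i))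

-- |E(V_a,V_b)| for a ≠ b: number of pairs (u,v) with u ∈ V_a, v ∈ V_b adjacent
-- (each such edge has exactly one endpoint in V_a since the classes are disjoint)
crossEdges : ∀ {n k} → SimpleGraph n → (Fin n → Fin k) → Fin k → Fin k → ℕ
crossEdges G χ a b =
  sumFin (λ u → if inClass χ a u then count (λ v → inClass χ b v ∧ adj G u v) else 0)

OneSided : ∀ {n k} → SimpleGraph n → (Fin n → Fin k) → Fin k → Fin k → Set
OneSided G χ a b =
  (a ≢ b) × (0 < crossEdges G χ a b) × (crossEdges G χ a b < classSize χ a * classSize χ b)

-- |D ∩ {ab, ba}|  (for a ≠ b the words ab and ba are distinct)
indicator : Bool → ℕ
indicator b = if b then 1 else 0

-- In a solution, a vertex of V_a and a vertex of V_b are adjacent exactly when the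
-- positions of their images in w are ordered as in a word of D ∩ {ab, ba}.  If D
-- contains neither ab nor ba there is no edge between V_a and V_b; if it contains
-- both, every pair is adjacent (the images are distinct positions, since they carry
-- different letters).  A one-sided pair excludes both extremes.
module Submission where

open import Defs hiding (sym)
open import Data.Nat using (ℕ; _+_; _*_)
open import Data.Nat.Properties using (<-irrefl; *-zeroʳ)
open import Data.Fin using (Fin; zero; suc; _<?_)
open import Data.Fin.Properties using (_≟_; <-cmp)
open import Data.Bool using (Bool; true; false; _∧_; _∨_; if_then_else_)
open import Data.Bool.Properties using (∧-distribʳ-∨; ∧-zeroʳ; ∧-identityʳ)
open import Data.Product using (_,_)
open import Data.Empty using (⊥-elim)
open import Relation.Nullary using (yes; no)
open import Relation.Nullary.Decidable using (⌊_⌋)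
open import Relation.Binary using (tri<; tri≈; tri>)
open import Relation.Binary.PropositionalEquality
  using (_≡_; _≢_; refl; sym; trans; cong; cong₂; module ≡-Reasoning)
open import Function.Bundles using (Bijection)

count-cong : ∀ {n} {p q : Fin n → Bool} → (∀ i → p i ≡ q i) → count p ≡ count q
count-cong {ℕ.zero} e = refl
count-cong {ℕ.suc n} e = cong₂ _+_ (cong indicator (e zero)) (count-cong (λ i → e (suc i)))

count-false : ∀ {n} → count {n} (λ _ → false) ≡ 0
count-false {ℕ.zero} = refl
count-false {ℕ.suc n} = count-false {n}

sumFin-cong : ∀ {n} {f g : Fin n → ℕ} → (∀ i → f i ≡ g i) → sumFin f ≡ sumFin g
sumFin-cong {ℕ.zero} e = refl
sumFin-cong {ℕ.suc n} e = cong₂ _+_ (e zero) (sumFin-cong (λ i → e (suc i)))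

sumFin-if-const : ∀ {n} (p : Fin n → Bool) (c : ℕ) →
                  sumFin (λ i → if p i then c else 0) ≡ count p * c
sumFin-if-const {ℕ.zero} p c = refl
sumFin-if-const {ℕ.suc n} p c with p zero
... | true  = cong (c +_) (sumFin-if-const (λ i → p (suc i)) c)
... | false = sumFin-if-const (λ i → p (suc i)) c

⌊<?⌋-connex : ∀ {n} {i j : Fin n} → i ≢ j → ⌊ i <? j ⌋ ∨ ⌊ j <? i ⌋ ≡ true
⌊<?⌋-connex {i = i} {j} i≢j with i <? j | j <? i
... | yes _  | _      = refl
... | no  _  | yes _  = refl
... | no i≮j | no j≮i with <-cmp i j
...   | tri< i<j _ _ = ⊥-elim (i≮j i<j)
...   | tri≈ _ i≡j _ = ⊥-elim (i≢j i≡j)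
...   | tri> _ _ j<i = ⊥-elim (j≮i j<i)

letterAdj-uniform : ∀ {n k} (D : Fin k → Fin k → Bool) (w : Fin n → Fin k) {i j : Fin n} {d : Bool}
                  → i ≢ j → D (w i) (w j) ≡ d → D (w j) (w i) ≡ d → letterAdj D w i j ≡ d
letterAdj-uniform D w {i} {j} {d} i≢j ij ji = begin
  (⌊ i <? j ⌋ ∧ D (w i) (w j)) ∨ (⌊ j <? i ⌋ ∧ D (w j) (w i))
    ≡⟨ cong₂ (λ x y → (⌊ i <? j ⌋ ∧ x) ∨ (⌊ j <? i ⌋ ∧ y)) ij ji ⟩
  (⌊ i <? j ⌋ ∧ d) ∨ (⌊ j <? i ⌋ ∧ d)
    ≡⟨ sym (∧-distribʳ-∨ d ⌊ i <? j ⌋ ⌊ j <? i ⌋) ⟩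
  (⌊ i <? j ⌋ ∨ ⌊ j <? i ⌋) ∧ d
    ≡⟨ cong (_∧ d) (⌊<?⌋-connex i≢j) ⟩
  d ∎
  where open ≡-Reasoning

AdjacencyBetween : ∀ {n k} → SimpleGraph n → (Fin n → Fin k) → Fin k → Fin k → Bool → Set
AdjacencyBetween G χ a b d = ∀ u v → χ u ≡ a → χ v ≡ b → adj G u v ≡ d

crossEdges-uniform : ∀ {n k} (G : SimpleGraph n) (χ : Fin n → Fin k) {a b : Fin k} {d : Bool}
                   → AdjacencyBetween G χ a b d
                   → crossEdges G χ a b ≡ classSize χ a * count (λ v → inClass χ b v ∧ d)
crossEdges-uniform G χ {a} {b} {d} uniform =
  trans (sumFin-cong row) (sumFin-if-const (inClass χ a) _)
  where
  row : ∀ u → (if inClass χ a u then count (λ v → inClass χ b v ∧ adj G u v) else 0)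
            ≡ (if inClass χ a u then count (λ v → inClass χ b v ∧ d) else 0)
  row u with χ u ≟ a
  ... | no  _  = refl
  ... | yes χu = count-cong entry
    where
    entry : ∀ v → inClass χ b v ∧ adj G u v ≡ inClass χ b v ∧ d
    entry v with χ v ≟ b
    ... | no  _  = refl
    ... | yes χv = uniform u v χu χv

crossEdges-empty : ∀ {n k} (G : SimpleGraph n) (χ : Fin n → Fin k) {a b : Fin k}
                 → AdjacencyBetween G χ a b false → crossEdges G χ a b ≡ 0
crossEdges-empty {n} G χ {a} {b} none = begin
  crossEdges G χ a b                                   ≡⟨ crossEdges-uniform G χ none ⟩
  classSize χ a * count (λ v → inClass χ b v ∧ false)  ≡⟨ cong (classSize χ a *_) noNeighbours ⟩
  classSize χ a * 0                                    ≡⟨ *-zeroʳ (classSize χ a) ⟩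
  0                                                    ∎
  where
  open ≡-Reasoning
  noNeighbours : count (λ v → inClass χ b v ∧ false) ≡ 0
  noNeighbours = trans (count-cong (λ v → ∧-zeroʳ (inClass χ b v))) (count-false {n})

crossEdges-complete : ∀ {n k} (G : SimpleGraph n) (χ : Fin n → Fin k) {a b : Fin k}
                    → AdjacencyBetween G χ a b true
                    → crossEdges G χ a b ≡ classSize χ a * classSize χ b
crossEdges-complete G χ {a} {b} all = trans (crossEdges-uniform G χ all)
  (cong (classSize χ a *_) (count-cong (λ v → ∧-identityʳ (inClass χ b v))))

solution-adjacencyBetween : ∀ {n k} (G : SimpleGraph n) (χ w : Fin n → Fin k) (D : Fin k → Fin k → Bool)
                          → IsSolution G χ w D → {a b : Fin k} {d : Bool}
                          → a ≢ b → D a b ≡ d → D b a ≡ d → AdjacencyBetween G χ a b d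
solution-adjacencyBetween G χ w D (f , iso , colour) {a} {b} a≢b ab ba u v χu χv =
  trans (iso u v) (letterAdj-uniform D w positions-differ
    (trans (cong₂ D wu wv) ab) (trans (cong₂ D wv wu) ba))
  where
  open Bijection f using (to)
  wu : w (to u) ≡ a
  wu = trans (colour u) χu
  wv : w (to v) ≡ b
  wv = trans (colour v) χv
  positions-differ : to u ≢ to v
  positions-differ eq = a≢b (trans (sym wu) (trans (cong w eq) wv))

lemma3 : ∀ {n k} (G : SimpleGraph n) (χ : Fin n → Fin k) (w : Fin n → Fin k)
         → IsInstance G χ w
         → (a b : Fin k) → OneSided G χ a b
         → (D : Fin k → Fin k → Bool) → IsSolution G χ w D
         → indicator (D a b) + indicator (D b a) ≡ 1
lemma3 G χ w _ a b (a≢b , nonempty , incomplete) D solution = cases (D a b) (D b a) refl refl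
  where
  uniform : ∀ {d} → D a b ≡ d → D b a ≡ d → AdjacencyBetween G χ a b d
  uniform = solution-adjacencyBetween G χ w D solution a≢b
  cases : ∀ x y → D a b ≡ x → D b a ≡ y → indicator x + indicator y ≡ 1
  cases false true  _  _  = refl
  cases true  false _  _  = refl
  cases false false ab ba = ⊥-elim (<-irrefl (sym (crossEdges-empty G χ (uniform ab ba))) nonempty)
  cases true  true  ab ba = ⊥-elim (<-irrefl (crossEdges-complete G χ (uniform ab ba)) incomplete)
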